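{- Let $(E,X)$ be an execution with $X=(\mathrm{ws},\mathrm{rf})$, and suppose $\mathrm{uniproc}(E,X)$ holds, i.e. $\mathrm{ws}\cup\mathrm{rf}\cup\mathrm{fr}\cup\mathrm{po\text{ - }loc}$ is acyclic. Then for every read $r$ there do not exist two distinct writes $w\neq w'$ with $(w,r)\in\mathrm{rf}$ and $(w',r)\in\mathrm{rf}$.
   Context: An event is a memory read or write with an address and a value. An event structure $E=(\mathbb{E},\mathrm{po})$ consists of a set of events and a program order $\mathrm{po}$ (a total order per processor); $\mathrm{po\text{ - }loc}$ is the restriction of $\mathrm{po}$ to pairs of events with the same address. An execution witness $X=(\mathrm{ws},\mathrm{rf})$ consists of the write serialisation $\mathrm{ws}$, a strict total order on the writes to each address (relating only writes to the same address), and the read-from relation $\mathrm{rf}$, relating a write $w$ to a read $r$ of the same address when $r$ reads the value written by $w$. The from-read relation is $\mathrm{fr}=\{(r,w)\mid \exists w'.\ (w',r)\in\mathrm{rf}\wedge (w',w)\in\mathrm{ws}\}$. -}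

module Defs where

open import Data.Product using (_×_; ∃; ∃-syntax)
open import Data.Sum using (_⊎_)
open import Relation.Nullary using (¬_)
open import Relation.Binary.PropositionalEquality using (_≡_; _≢_)
open import Relation.Binary.Core using (Rel)
open import Level using (0ℓ)
open import Relation.Binary.Construct.Closure.Transitive using (TransClosure)

data Kind : Set where
  read  : Kind
  write : Kind

record EventStructure : Set₁ where
  field
    Ev   : Set
    Addr : Set
    Val  : Set
    Proc : Set
    kind : Ev → Kind
    addr : Ev → Addr
    val  : Ev → Val
    proc : Ev → Proc
    po   : Rel Ev 0ℓ
    po-irrefl : ∀ e → ¬ po e e
    po-trans  : ∀ {a b c} → po a b → po b c → po a c
    po-sameProc : ∀ {a b} → po a b → proc a ≡ proc b
    po-total  : ∀ a b → proc a ≡ proc b → a ≢ b → po a b ⊎ po b a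

  IsRead : Ev → Set
  IsRead e = kind e ≡ read

  IsWrite : Ev → Set
  IsWrite e = kind e ≡ write

  po-loc : Rel Ev 0ℓ
  po-loc a b = po a b × addr a ≡ addr b

record ExecutionWitness (E : EventStructure) : Set₁ where
  open EventStructure E
  field
    ws : Rel Ev 0ℓ
    rf : Rel Ev 0ℓ
    ws-writes   : ∀ {a b} → ws a b → IsWrite a × IsWrite b × addr a ≡ addr b
    ws-irrefl   : ∀ e → ¬ ws e e
    ws-trans    : ∀ {a b c} → ws a b → ws b c → ws a c
    ws-total    : ∀ a b → IsWrite a → IsWrite b → addr a ≡ addr b → a ≢ b →
                  ws a b ⊎ ws b a
    rf-wf       : ∀ {w r} → rf w r →
                  IsWrite w × IsRead r × addr w ≡ addr r × val w ≡ val r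

  fr : Rel Ev 0ℓ
  fr r w = ∃[ w' ] (rf w' r × ws w' w)

_∪_ : ∀ {A : Set} → Rel A 0ℓ → Rel A 0ℓ → Rel A 0ℓ
(R ∪ S) a b = R a b ⊎ S a b
infixr 5 _∪_

Acyclic : ∀ {A : Set} → Rel A 0ℓ → Set
Acyclic {A} R = ∀ (x : A) → ¬ TransClosure R x x

uniproc : (E : EventStructure) → ExecutionWitness E → Set
uniproc E X = Acyclic (ws ∪ rf ∪ fr ∪ po-loc)
  where open EventStructure E
        open ExecutionWitness X

module Submission where

-- Idea: suppose r reads from both w and w' with w ≢ w'.  Both are writes to
-- the address of r, so ws orders them, say ws w w'.  Then (r, w') ∈ fr,
-- because r reads from w and w precedes w' in ws; together with
-- (w', r) ∈ rf this closes the two-step cycle  r -fr-> w' -rf-> r  in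
-- ws ∪ rf ∪ fr ∪ po-loc, contradicting acyclicity.

open import Defs
open import Data.Product using (_×_; ∃-syntax; _,_)
open import Data.Sum using (_⊎_; inj₁; inj₂)
open import Relation.Nullary using (¬_)
open import Relation.Binary.PropositionalEquality using (_≢_; trans; sym)
open import Relation.Binary.Construct.Closure.Transitive using ([_]; _∷_)

module _ {E : EventStructure} (X : ExecutionWitness E) where
  open EventStructure E
  open ExecutionWitness X

  rf-sources-ws-related : ∀ {w w' r} → w ≢ w' → rf w r → rf w' r →
                          ws w w' ⊎ ws w' w
  rf-sources-ws-related {w} {w'} w≢w' rf-w rf-w'
    with rf-wf rf-w | rf-wf rf-w'
  ... | (write-w , _ , addr-w , _) | (write-w' , _ , addr-w' , _) =
    ws-total w w' write-w write-w' (trans addr-w (sym addr-w')) w≢w'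

  fr-rf-cycle : uniproc E X → ∀ {w w' r} → rf w r → rf w' r → ¬ ws w w'
  fr-rf-cycle acyclic {w} {w'} {r} rf-w rf-w' ws-w-w' =
    acyclic r (fr-edge ∷ [ rf-edge ])
    where
      fr-edge : (ws ∪ rf ∪ fr ∪ po-loc) r w'
      fr-edge = inj₂ (inj₂ (inj₁ (w , rf-w , ws-w-w')))
      rf-edge : (ws ∪ rf ∪ fr ∪ po-loc) w' r
      rf-edge = inj₂ (inj₁ rf-w')

lemma3 : (E : EventStructure) (X : ExecutionWitness E) → uniproc E X →
    ∀ r → EventStructure.IsRead E r →
    ¬ (∃[ w ] ∃[ w' ] (w ≢ w' × ExecutionWitness.rf X w r × ExecutionWitness.rf X w' r))
lemma3 E X acyclic r _ (w , w' , w≢w' , rf-w , rf-w')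
  with rf-sources-ws-related X w≢w' rf-w rf-w'
... | inj₁ ws-w-w' = fr-rf-cycle X acyclic rf-w rf-w' ws-w-w'
... | inj₂ ws-w'-w = fr-rf-cycle X acyclic rf-w' rf-w ws-w'-w
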